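{- There is an absolute constant $C$ such that for all positive integers $w,n,k$ and all functions $h_1:[w]\to[k]$, $h_2:[n]\to[k]$, the $k$-bin hash defined by $h_1,h_2$ is $C$-switching-cost bounded.
   Context: A worker/task input is a pair $(W,T)$ with $W\subseteq[w]$, $T\subseteq[n]$, $|W|=|T|$. The $k$-bin hash defined by $h_1,h_2$ places each $\omega\in W$ in bin $h_1(\omega)$ and each $\tau\in T$ in bin $h_2(\tau)$, and in each bin containing at least one worker and at least one task matches the smallest such worker to the smallest such task; the set of assignments it makes is the set of matched pairs. Inputs $(W_1,T_1),(W_2,T_2)$ are unit distance if $|W_1\setminus W_2|+|W_2\setminus W_1|+|T_1\setminus T_2|+|T_2\setminus T_1|\le 2$. An algorithm is $s$-switching-cost bounded if for every unit-distance pair of inputs, the sets of assignments it makes on the two inputs have symmetric difference of size at most $s$. -}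

module Defs where

open import Data.Nat using (ℕ; _+_; _≤_)
open import Data.Fin using (Fin; _≟_)
open import Data.Fin.Subset using (Subset; _─_; ∣_∣)
open import Data.Fin.Subset.Properties using (_∈?_)
open import Data.Fin.Properties using () renaming (_≟_ to _≟F_)
open import Data.List using (List; []; _∷_; filter; allFin; length)
open import Data.Maybe using (Maybe; just; nothing)
open import Data.Product using (_×_; _,_)
open import Data.Product.Properties using (≡-dec)
open import Relation.Nullary using (¬?)
open import Relation.Nullary.Decidable using (_×-dec_)
open import Relation.Binary.PropositionalEquality using (_≡_)
import Data.List.Membership.DecPropositional as DecMem

record Input (w n : ℕ) : Set where
  constructor mkInput
  field
    workers : Subset w
    tasks   : Subset n
    balanced : ∣ workers ∣ ≡ ∣ tasks ∣
open Input public

-- first element of a list (the lists below are in increasing order)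
head? : {A : Set} → List A → Maybe A
head? []      = nothing
head? (x ∷ _) = just x

smallestIn : {m k : ℕ} → (Fin m → Fin k) → Subset m → Fin k → Maybe (Fin m)
smallestIn {m} h S b = head? (filter (λ x → (x ∈? S) ×-dec (h x ≟ b)) (allFin m))

binPairs : {w n k : ℕ} → (Fin w → Fin k) → (Fin n → Fin k) →
           Subset w → Subset n → List (Fin k) → List (Fin w × Fin n)
binPairs h₁ h₂ W T [] = []
binPairs h₁ h₂ W T (b ∷ bs) with smallestIn h₁ W b | smallestIn h₂ T b
... | just ω | just τ = (ω , τ) ∷ binPairs h₁ h₂ W T bs
... | _      | _      = binPairs h₁ h₂ W T bs

kBinHash : {w n k : ℕ} → (Fin w → Fin k) → (Fin n → Fin k) →
           Input w n → List (Fin w × Fin n)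
kBinHash {k = k} h₁ h₂ I = binPairs h₁ h₂ (workers I) (tasks I) (allFin k)

-- An algorithm maps each input to its set of assignments (as a duplicate-free list).
Algorithm : ℕ → ℕ → Set
Algorithm w n = Input w n → List (Fin w × Fin n)

module _ {w n : ℕ} where
  private
    decPair = ≡-dec (_≟F_ {w}) (_≟F_ {n})
  open DecMem decPair using () renaming (_∈?_ to _∈L?_)

  diffSize : List (Fin w × Fin n) → List (Fin w × Fin n) → ℕ
  diffSize A₁ A₂ = length (filter (λ p → ¬? (p ∈L? A₂)) A₁)

  symDiffSize : List (Fin w × Fin n) → List (Fin w × Fin n) → ℕ
  symDiffSize A₁ A₂ = diffSize A₁ A₂ + diffSize A₂ A₁

  UnitDistance : Input w n → Input w n → Set
  UnitDistance I₁ I₂ =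
    ∣ workers I₁ ─ workers I₂ ∣ + ∣ workers I₂ ─ workers I₁ ∣
      + ∣ tasks I₁ ─ tasks I₂ ∣ + ∣ tasks I₂ ─ tasks I₁ ∣ ≤ 2

  SwitchingCostBounded : ℕ → Algorithm w n → Set
  SwitchingCostBounded s A =
    ∀ (I₁ I₂ : Input w n) → UnitDistance I₁ I₂ → symDiffSize (A I₁) (A I₂) ≤ s

module Submission where

-- Call a bin dirty if it
-- receives a worker or a task on which the two inputs differ; since the inputs
-- are at unit distance there are at most 2 dirty bins (`dirtyBins-length`).
-- A clean bin holds the same workers and tasks under both inputs, so its
-- smallest worker and task coincide (`smallestIn-stable`) and it makes the
-- same assignment (`clean-bins-agree`). Writing the output as
-- `mapMaybe (assignment W T) (allFin k)`, every assignment made on one input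
-- but not on the other therefore comes from a distinct dirty bin
-- (`filter-mapMaybe-≤`), so each half of the symmetric difference has size
-- at most 2 and the whole has size at most 4.

open import Defs
open import Data.Nat using (ℕ; NonZero; suc; _+_; _≤_; z≤n; s≤s)
open import Data.Nat.Properties using (≤-trans; m≤n⇒m≤1+n; +-mono-≤; +-suc)
open import Data.Fin using (Fin; zero; suc) renaming (_≟_ to _≟F_)
open import Data.Fin.Subset using (Subset; _─_; ∣_∣; inside; outside; _∈_)
open import Data.Fin.Subset.Properties using (x∈p∧x∉q⇒x∈p─q) renaming (_∈?_ to _∈S?_)
open import Data.Vec using ([]; _∷_; here; there)
open import Data.List using (List; []; _∷_; filter; allFin; length; map; mapMaybe; _++_; [_])
open import Data.List.Properties using (length-map; length-++; filter-≐)
open import Data.List.Membership.Propositional using () renaming (_∈_ to _∈L_; _∉_ to _∉L_)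
open import Data.List.Membership.Propositional.Properties
  using (∈-map⁺; ∈-++⁺ˡ; ∈-++⁺ʳ; ∈-++⁻; ∈-filter⁻; ∈-∃++; ∈-allFin)
open import Data.List.Relation.Unary.Any using (here; there)
open import Data.List.Relation.Unary.All using (lookup)
open import Data.List.Relation.Unary.AllPairs using (_∷_)
open import Data.List.Relation.Unary.Unique.Propositional using (Unique)
import Data.List.Relation.Unary.Unique.Propositional.Properties as Unique
open import Data.Maybe using (Maybe; just; nothing; zip)
open import Data.Product using (Σ; _×_; _,_; proj₂)
open import Data.Product.Properties using (≡-dec)
open import Data.Sum using (inj₁; inj₂)
open import Data.Empty using (⊥-elim)
open import Relation.Nullary using (yes; no; ¬_; ¬?)
open import Relation.Nullary.Decidable using (_×-dec_)
open import Level using (0ℓ)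
open import Relation.Unary using (Pred; Decidable)
open import Relation.Binary.PropositionalEquality using (_≡_; refl; sym; trans; cong; cong₂; subst; _≢_)
import Data.List.Membership.DecPropositional as DecMembership

members : ∀ {m} → Subset m → List (Fin m)
members []            = []
members (inside ∷ p)  = zero ∷ map suc (members p)
members (outside ∷ p) = map suc (members p)

members-length : ∀ {m} (p : Subset m) → length (members p) ≡ ∣ p ∣
members-length []            = refl
members-length (inside ∷ p)  = cong suc (trans (length-map suc (members p)) (members-length p))
members-length (outside ∷ p) = trans (length-map suc (members p)) (members-length p)

members-complete : ∀ {m} {x : Fin m} {p : Subset m} → x ∈ p → x ∈L members p
members-complete {p = inside ∷ p}  here        = here refl
members-complete {p = inside ∷ p}  (there x∈p) = there (∈-map⁺ suc (members-complete x∈p))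
members-complete {p = outside ∷ p} (there x∈p) = ∈-map⁺ suc (members-complete x∈p)

image : ∀ {m k} → (Fin m → Fin k) → Subset m → List (Fin k)
image h S = map h (members S)

image-length : ∀ {m k} (h : Fin m → Fin k) (S : Subset m) → length (image h S) ≡ ∣ S ∣
image-length h S = trans (length-map h (members S)) (members-length S)

image-complete : ∀ {m k} (h : Fin m → Fin k) {S : Subset m} {x : Fin m} → x ∈ S → h x ∈L image h S
image-complete h x∈S = ∈-map⁺ h (members-complete x∈S)

module _ {A : Set} where

  ∈-delete : ∀ {x y : A} (ys zs : List A) → y ∈L ys ++ [ x ] ++ zs → y ≢ x → y ∈L ys ++ zs
  ∈-delete ys zs y∈ y≢x with ∈-++⁻ ys y∈
  ... | inj₁ y∈ys        = ∈-++⁺ˡ y∈ys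
  ... | inj₂ (here y≡x)  = ⊥-elim (y≢x y≡x)
  ... | inj₂ (there y∈zs) = ∈-++⁺ʳ ys y∈zs

  unique-⊆-length : ∀ (xs B : List A) → Unique xs → (∀ {x} → x ∈L xs → x ∈L B) → length xs ≤ length B
  unique-⊆-length []       B _             _  = z≤n
  unique-⊆-length (x ∷ xs) B (x∉xs ∷ uniq) xs⊆B with ∈-∃++ (xs⊆B (here refl))
  ... | ys , zs , refl = subst (suc (length xs) ≤_) (sym length-B) (s≤s (unique-⊆-length xs (ys ++ zs) uniq xs⊆B-x))
    where
    length-B : length (ys ++ [ x ] ++ zs) ≡ suc (length (ys ++ zs))
    length-B = trans (length-++ ys) (trans (+-suc (length ys) (length zs)) (cong suc (sym (length-++ ys))))

    xs⊆B-x : ∀ {y} → y ∈L xs → y ∈L ys ++ zs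
    xs⊆B-x y∈xs = ∈-delete ys zs (xs⊆B (there y∈xs)) (λ y≡x → lookup x∉xs y∈xs (sym y≡x))

module _ {A B : Set} {P : Pred B 0ℓ} {Q : Pred A 0ℓ} (P? : Decidable P) (Q? : Decidable Q) where

  filter-mapMaybe-≤ : (f : A → Maybe B) → (∀ x y → f x ≡ just y → P y → Q x) →
                      ∀ xs → length (filter P? (mapMaybe f xs)) ≤ length (filter Q? xs)
  filter-mapMaybe-≤ f traced []       = z≤n
  filter-mapMaybe-≤ f traced (x ∷ xs) with f x in fx≡ | Q? x
  ... | nothing | yes _ = m≤n⇒m≤1+n (filter-mapMaybe-≤ f traced xs)
  ... | nothing | no _  = filter-mapMaybe-≤ f traced xs
  ... | just y  | yes _ with P? y
  ...   | yes _ = s≤s (filter-mapMaybe-≤ f traced xs)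
  ...   | no _  = m≤n⇒m≤1+n (filter-mapMaybe-≤ f traced xs)
  filter-mapMaybe-≤ f traced (x ∷ xs) | just y | no ¬Qx with P? y
  ...   | yes Py = ⊥-elim (¬Qx (traced x y fx≡ Py))
  ...   | no _   = filter-mapMaybe-≤ f traced xs

∈-mapMaybe : ∀ {A B : Set} (f : A → Maybe B) {x : A} {y : B} → ∀ xs → x ∈L xs → f x ≡ just y → y ∈L mapMaybe f xs
∈-mapMaybe f (x ∷ xs) (here refl) fx≡ rewrite fx≡ = here refl
∈-mapMaybe f (x′ ∷ xs) (there x∈xs) fx≡ with f x′
... | nothing = ∈-mapMaybe f xs x∈xs fx≡
... | just _  = there (∈-mapMaybe f xs x∈xs fx≡)

fiber-⊆ : ∀ {m k} (h : Fin m → Fin k) (S₁ S₂ : Subset m) (b : Fin k) →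
          (∀ x → x ∈ S₁ ─ S₂ → h x ≢ b) → ∀ {x} → x ∈ S₁ × h x ≡ b → x ∈ S₂ × h x ≡ b
fiber-⊆ h S₁ S₂ b clean {x} (x∈S₁ , hx≡b) with x ∈S? S₂
... | yes x∈S₂ = x∈S₂ , hx≡b
... | no x∉S₂  = ⊥-elim (clean x (x∈p∧x∉q⇒x∈p─q x∈S₁ x∉S₂) hx≡b)

smallestIn-stable : ∀ {m k} (h : Fin m → Fin k) (S₁ S₂ : Subset m) (b : Fin k) →
                    (∀ x → x ∈ S₁ ─ S₂ → h x ≢ b) → (∀ x → x ∈ S₂ ─ S₁ → h x ≢ b) →
                    smallestIn h S₁ b ≡ smallestIn h S₂ b
smallestIn-stable {m} h S₁ S₂ b clean₁₂ clean₂₁ =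
  cong head? (filter-≐ (inBin S₁) (inBin S₂) (fiber-⊆ h S₁ S₂ b clean₁₂ , fiber-⊆ h S₂ S₁ b clean₂₁) (allFin m))
  where
  inBin : (S : Subset m) → Decidable (λ x → x ∈ S × h x ≡ b)
  inBin S x = (x ∈S? S) ×-dec (h x ≟F b)

module KBinHash {w n k : ℕ} (h₁ : Fin w → Fin k) (h₂ : Fin n → Fin k) where

  open DecMembership (_≟F_ {k}) using () renaming (_∈?_ to _∈B?_)
  open DecMembership (≡-dec (_≟F_ {w}) (_≟F_ {n})) using () renaming (_∈?_ to _∈A?_)

  assignment : Subset w → Subset n → Fin k → Maybe (Fin w × Fin n)
  assignment W T b = zip (smallestIn h₁ W b) (smallestIn h₂ T b)

  binPairs-mapMaybe : ∀ W T bs → binPairs h₁ h₂ W T bs ≡ mapMaybe (assignment W T) bs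
  binPairs-mapMaybe W T []       = refl
  binPairs-mapMaybe W T (b ∷ bs) with smallestIn h₁ W b | smallestIn h₂ T b
  ... | just ω  | just τ  = cong ((ω , τ) ∷_) (binPairs-mapMaybe W T bs)
  ... | just _  | nothing = binPairs-mapMaybe W T bs
  ... | nothing | _       = binPairs-mapMaybe W T bs

  bins-in-≤ : (D : List (Fin k)) → length (filter (_∈B? D) (allFin k)) ≤ length D
  bins-in-≤ D = unique-⊆-length (filter (_∈B? D) (allFin k)) D
                  (Unique.filter⁺ (_∈B? D) (Unique.allFin⁺ k))
                  (λ b∈ → proj₂ (∈-filter⁻ (_∈B? D) {xs = allFin k} b∈))

  lost-≤ : (g₁ g₂ : Fin k → Maybe (Fin w × Fin n)) (D : List (Fin k)) →
           (∀ b → b ∉L D → g₁ b ≡ g₂ b) →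
           diffSize (mapMaybe g₁ (allFin k)) (mapMaybe g₂ (allFin k)) ≤ length D
  lost-≤ g₁ g₂ D agree =
    ≤-trans (filter-mapMaybe-≤ (λ p → ¬? (p ∈A? A₂)) (_∈B? D) g₁ lost-in-D (allFin k)) (bins-in-≤ D)
    where
    A₂ : List (Fin w × Fin n)
    A₂ = mapMaybe g₂ (allFin k)

    lost-in-D : ∀ b p → g₁ b ≡ just p → ¬ p ∈L A₂ → b ∈L D
    lost-in-D b p g₁b≡p p∉A₂ with b ∈B? D
    ... | yes b∈D = b∈D
    ... | no b∉D  = ⊥-elim (p∉A₂ (∈-mapMaybe g₂ (allFin k) (∈-allFin b) (trans (sym (agree b b∉D)) g₁b≡p)))

  module Dirty (W₁ W₂ : Subset w) (T₁ T₂ : Subset n) where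

    dirtyBins : List (Fin k)
    dirtyBins = ((image h₁ (W₁ ─ W₂) ++ image h₁ (W₂ ─ W₁)) ++ image h₂ (T₁ ─ T₂)) ++ image h₂ (T₂ ─ T₁)

    dirtyBins-length : length dirtyBins ≡ ∣ W₁ ─ W₂ ∣ + ∣ W₂ ─ W₁ ∣ + ∣ T₁ ─ T₂ ∣ + ∣ T₂ ─ T₁ ∣
    dirtyBins-length =
      length-++₄ (image h₁ (W₁ ─ W₂)) (image h₁ (W₂ ─ W₁)) (image h₂ (T₁ ─ T₂)) (image h₂ (T₂ ─ T₁))
        (image-length h₁ (W₁ ─ W₂)) (image-length h₁ (W₂ ─ W₁)) (image-length h₂ (T₁ ─ T₂)) (image-length h₂ (T₂ ─ T₁))
      where
      length-++₄ : ∀ (as bs cs ds : List (Fin k)) {a b c d} →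
                   length as ≡ a → length bs ≡ b → length cs ≡ c → length ds ≡ d →
                   length (((as ++ bs) ++ cs) ++ ds) ≡ a + b + c + d
      length-++₄ as bs cs ds refl refl refl refl =
        trans (length-++ ((as ++ bs) ++ cs))
              (cong (_+ length ds) (trans (length-++ (as ++ bs)) (cong (_+ length cs) (length-++ as))))

    clean-bins-agree : ∀ b → b ∉L dirtyBins → assignment W₁ T₁ b ≡ assignment W₂ T₂ b
    clean-bins-agree b b∉D =
      cong₂ zip (smallestIn-stable h₁ W₁ W₂ b (avoids h₁ worker₁₂) (avoids h₁ worker₂₁))
                (smallestIn-stable h₂ T₁ T₂ b (avoids h₂ task₁₂) (avoids h₂ task₂₁))
      where
      avoids : ∀ {m} (h : Fin m → Fin k) {S : Subset m} → (∀ {x} → x ∈ S → h x ∈L dirtyBins) →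
               ∀ x → x ∈ S → h x ≢ b
      avoids h into x x∈S hx≡b = b∉D (subst (_∈L dirtyBins) hx≡b (into x∈S))

      worker₁₂ : ∀ {x} → x ∈ W₁ ─ W₂ → h₁ x ∈L dirtyBins
      worker₁₂ x∈ = ∈-++⁺ˡ (∈-++⁺ˡ (∈-++⁺ˡ (image-complete h₁ x∈)))

      worker₂₁ : ∀ {x} → x ∈ W₂ ─ W₁ → h₁ x ∈L dirtyBins
      worker₂₁ x∈ = ∈-++⁺ˡ (∈-++⁺ˡ (∈-++⁺ʳ (image h₁ (W₁ ─ W₂)) (image-complete h₁ x∈)))

      task₁₂ : ∀ {x} → x ∈ T₁ ─ T₂ → h₂ x ∈L dirtyBins
      task₁₂ x∈ = ∈-++⁺ˡ (∈-++⁺ʳ (image h₁ (W₁ ─ W₂) ++ image h₁ (W₂ ─ W₁)) (image-complete h₂ x∈))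

      task₂₁ : ∀ {x} → x ∈ T₂ ─ T₁ → h₂ x ∈L dirtyBins
      task₂₁ x∈ = ∈-++⁺ʳ ((image h₁ (W₁ ─ W₂) ++ image h₁ (W₂ ─ W₁)) ++ image h₂ (T₁ ─ T₂)) (image-complete h₂ x∈)

  switching-cost-≤-4 : SwitchingCostBounded 4 (kBinHash h₁ h₂)
  switching-cost-≤-4 (mkInput W₁ T₁ _) (mkInput W₂ T₂ _) unit
    rewrite binPairs-mapMaybe W₁ T₁ (allFin k) | binPairs-mapMaybe W₂ T₂ (allFin k) =
      +-mono-≤ (≤-trans (lost-≤ (assignment W₁ T₁) (assignment W₂ T₂) dirtyBins clean-bins-agree) two-dirty)
               (≤-trans (lost-≤ (assignment W₂ T₂) (assignment W₁ T₁) dirtyBins (λ b b∉D → sym (clean-bins-agree b b∉D))) two-dirty)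
    where
    open Dirty W₁ W₂ T₁ T₂
    two-dirty : length dirtyBins ≤ 2
    two-dirty = subst (_≤ 2) (sym dirtyBins-length) unit

lemma11 : Σ ℕ λ C → ∀ (w n k : ℕ) → .{{_ : NonZero w}} → .{{_ : NonZero n}} → .{{_ : NonZero k}} →
            (h₁ : Fin w → Fin k) → (h₂ : Fin n → Fin k) →
            SwitchingCostBounded C (kBinHash h₁ h₂)
lemma11 = 4 , λ w n k h₁ h₂ → KBinHash.switching-cost-≤-4 h₁ h₂
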